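{- Let $W=w_1w_2\dots w_n$ be a word over an alphabet $\mathbb{A}$. For $\alpha\in\mathbb{A}$ and $1\leq i\leq n+1$, let $E(i,\alpha)=w_1\dots w_{i-1}\alpha w_i\dots w_n$ be the extension of $W$ obtained by inserting $\alpha$ as the $i$-th letter. If $(i,\alpha)\neq(j,\beta)$ and $E(i,\alpha)=E(j,\beta)$, then this word is not square-free. In other words, square-free extensions of $W$ obtained by different insertions are distinct words.
   Context: A word is a finite sequence of letters. A square is a nonempty word of the form $YY$; a word is square-free if none of its factors (contiguous subwords) is a square. -}

module Defs where

open import Data.List using (List; []; _∷_; _++_; length; take; drop)
open import Data.Fin using (Fin; toℕ)
open import Data.Nat using (ℕ; suc)
open import Data.Product using (∃-syntax; _×_)
open import Relation.Binary.PropositionalEquality using (_≡_)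
open import Relation.Nullary using (¬_)

Word : Set → Set
Word A = List A

IsSquare : {A : Set} → Word A → Set
IsSquare {A} S = ∃[ Y ] (¬ (Y ≡ []) × (S ≡ Y ++ Y))

IsFactor : {A : Set} → Word A → Word A → Set
IsFactor F W = ∃[ U ] ∃[ V ] (W ≡ U ++ F ++ V)

SquareFree : {A : Set} → Word A → Set
SquareFree W = ∀ F → IsFactor F W → ¬ IsSquare F

-- E W i α : insert α into W so that it becomes the (toℕ i + 1)-th letter.
-- The index i : Fin (suc (length W)) ranges over 0 … n, corresponding to the
-- paper's 1 ≤ i ≤ n+1.
E : {A : Set} → (W : Word A) → Fin (suc (length W)) → A → Word A
E W i α = take (toℕ i) W ++ α ∷ drop (toℕ i) W

-- If α is inserted at position k and β at a
-- later position m, the words agree on the prefix before k; at position k the first word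
-- has α, and the second has the letter that follows α in the first, so αα is a factor.
-- If the positions coincide, cancelling the common prefix forces α = β.
module Submission where

open import Defs
open import Data.List using ([]; _∷_; _++_; length; take; drop)
open import Data.List.Properties using (∷-injective; ∷-injectiveˡ; ∷-injectiveʳ; ++-cancelˡ)
open import Data.Fin using (Fin; toℕ)
open import Data.Fin.Properties using (toℕ-injective; toℕ≤pred[n])
open import Data.Nat using (ℕ; zero; suc; _<_; s≤s)
open import Data.Nat.Properties using (<-cmp; <-≤-trans)
open import Data.Product using (_,_)
open import Relation.Binary.Definitions using (tri<; tri≈; tri>)
open import Relation.Binary.PropositionalEquality using (_≡_; refl; sym; cong; subst)
open import Relation.Nullary using (¬_)

insertAt : {A : Set} → ℕ → A → Word A → Word A
insertAt k a W = take k W ++ a ∷ drop k W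

insertAt-injectiveˡ : {A : Set} (W : Word A) (k : ℕ) {a b : A} →
  insertAt k a W ≡ insertAt k b W → a ≡ b
insertAt-injectiveˡ W k eq = ∷-injectiveˡ (++-cancelˡ (take k W) _ _ eq)

insertAt-earlier⇒doubled : {A : Set} (W : Word A) {k m : ℕ} {a b : A} →
  k < m → k < length W → insertAt k a W ≡ insertAt m b W →
  IsFactor (a ∷ a ∷ []) (insertAt k a W)
insertAt-earlier⇒doubled (w ∷ ws) {zero} {suc m} _ _ eq with ∷-injective eq
... | refl , _ = [] , ws , refl
insertAt-earlier⇒doubled (w ∷ ws) {suc k} {suc m} (s≤s k<m) (s≤s k<n) eq
  with insertAt-earlier⇒doubled ws k<m k<n (∷-injectiveʳ eq)
... | U , V , ws≡ = w ∷ U , V , cong (w ∷_) ws≡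

doubled⇒¬SquareFree : {A : Set} {X : Word A} {a : A} →
  IsFactor (a ∷ a ∷ []) X → ¬ SquareFree X
doubled⇒¬SquareFree {a = a} aa∈X sf = sf _ aa∈X (a ∷ [] , (λ ()) , refl)

lemma3p5 : {A : Set} (W : Word A) (i j : Fin (suc (length W))) (α β : A) →
    ¬ ((i , α) ≡ (j , β)) → E W i α ≡ E W j β → ¬ SquareFree (E W i α)
lemma3p5 W i j α β i,α≢j,β eq with <-cmp (toℕ i) (toℕ j)
... | tri< i<j _ _ =
  doubled⇒¬SquareFree (insertAt-earlier⇒doubled W i<j (<-≤-trans i<j (toℕ≤pred[n] j)) eq)
... | tri> _ _ j<i =
  subst (λ X → ¬ SquareFree X) (sym eq)
    (doubled⇒¬SquareFree (insertAt-earlier⇒doubled W j<i (<-≤-trans j<i (toℕ≤pred[n] i)) (sym eq)))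
... | tri≈ _ i≡j _ with refl ← toℕ-injective i≡j =
  λ _ → i,α≢j,β (cong (i ,_) (insertAt-injectiveˡ W (toℕ i) eq))
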